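{- Let $n\ge1$, let $\mathcal P_m$ denote the set of permutations of size $m$ avoiding $213$, and let $E=\{a_1<\cdots<a_k\}$ be a nonempty subset of $\{1,\ldots,n-1\}$. Let $\mathcal P_n^{(E)}$ be the set of $\sigma\in\mathcal P_n$ such that every $a\in E$ is the index of a right-to-left minimum of $\sigma$ (i.e. $\sigma_a=\min_{a\le j\le n}\sigma_j$). Then there is a bijection $$\mathcal P_n^{(E)}\simeq \mathcal P_{a_1}\times\mathcal P_{a_2-a_1}\times\cdots\times\mathcal P_{a_k-a_{k-1}}\times\mathcal P_{n-a_k}.$$
   Context: A permutation $\sigma=(\sigma_1,\ldots,\sigma_n)$ avoids $213$ if there are no indices $i_1<i_2<i_3$ with $\sigma_{i_2}<\sigma_{i_1}<\sigma_{i_3}$. -}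

module Defs where

open import Level using (0ℓ)
open import Data.Nat using (ℕ; zero; suc; _∸_; _≤_; _<_)
open import Data.Fin using (Fin; toℕ)
import Data.Fin as F
open import Data.Vec using (Vec; lookup)
open import Data.List using (List; []; _∷_)
open import Data.List.Relation.Unary.Linked using (Linked)
open import Data.List.Relation.Unary.All using (All)
open import Data.Product using (Σ; _×_; proj₁; ∃)
open import Data.Unit using (⊤)
open import Relation.Nullary using (¬_)
open import Relation.Binary using (Setoid)
open import Relation.Binary.PropositionalEquality using (_≡_)
import Relation.Binary.PropositionalEquality as ≡
import Relation.Binary.Construct.On as On
open import Data.Product.Relation.Binary.Pointwise.NonDependent using (×-setoid)
open import Function.Bundles using (Bijection)

-- A permutation of size m in one-line notation: σ = (σ_1,…,σ_m) stored as a
-- vector of length m with entries in Fin m (values 0..m-1; positions 0..m-1),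
-- required to be injective (hence a bijection of Fin m).
IsPerm : ∀ {m} → Vec (Fin m) m → Set
IsPerm {m} σ = ∀ (i j : Fin m) → lookup σ i ≡ lookup σ j → i ≡ j

Avoids213 : ∀ {m} → Vec (Fin m) m → Set
Avoids213 {m} σ =
  ¬ (Σ (Fin m) λ i₁ → Σ (Fin m) λ i₂ → Σ (Fin m) λ i₃ →
       (i₁ F.< i₂) × (i₂ F.< i₃) ×
       (lookup σ i₂ F.< lookup σ i₁) × (lookup σ i₁ F.< lookup σ i₃))

Is213Avoiding : ∀ {m} → Vec (Fin m) m → Set
Is213Avoiding σ = IsPerm σ × Avoids213 σ

𝒫 : ℕ → Set
𝒫 m = Σ (Vec (Fin m) m) Is213Avoiding

𝒫-setoid : ℕ → Setoid 0ℓ 0ℓ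
𝒫-setoid m = On.setoid (≡.setoid (Vec (Fin m) m)) (proj₁ {B = Is213Avoiding})

-- The 1-based index a is the index of a right-to-left minimum of σ:
-- σ_a = min_{a ≤ j ≤ m} σ_j, i.e. σ_a ≤ σ_j for all j ≥ a.
-- (0-based position i corresponds to 1-based index suc (toℕ i).)
IsRLMinAt : ∀ {m} → Vec (Fin m) m → ℕ → Set
IsRLMinAt {m} σ a = ∀ (i j : Fin m) → suc (toℕ i) ≡ a → i F.≤ j → lookup σ i F.≤ lookup σ j

𝒫E : ℕ → List ℕ → Set
𝒫E n E = Σ (Vec (Fin n) n) λ σ → Is213Avoiding σ × All (IsRLMinAt σ) E

𝒫E-setoid : ℕ → List ℕ → Setoid 0ℓ 0ℓ
𝒫E-setoid n E = On.setoid (≡.setoid (Vec (Fin n) n))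
  (proj₁ {B = λ σ → Is213Avoiding σ × All (IsRLMinAt σ) E})

gaps : ℕ → List ℕ → ℕ → List ℕ
gaps prev []       n = (n ∸ prev) ∷ []
gaps prev (a ∷ as) n = (a ∸ prev) ∷ gaps a as n

∏𝒫 : List ℕ → Setoid 0ℓ 0ℓ
∏𝒫 []       = ≡.setoid ⊤
∏𝒫 (m ∷ ms) = ×-setoid (𝒫-setoid m) (∏𝒫 ms)

IsIndexSet : ℕ → List ℕ → Set
IsIndexSet n E = Linked _<_ E × All (λ a → 1 ≤ a × a < n) E

-- Let σ avoid 213 and have a right-to-left minimum at position a.  Every entry
-- after a exceeds σ_a, and an entry before a that exceeds σ_a exceeds every
-- entry after a, for otherwise it forms a 213 together with σ_a.  Counting then
-- shows that the n − a entries after a take exactly the values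
-- σ_a + 1, …, σ_a + (n − a).  Hence σ is the same thing as the pair made of
-- its standardised prefix σ_1 … σ_a ∈ 𝒫_a and its shifted suffix ∈ 𝒫_{n−a};
-- every such pair arises, and the suffix has its right-to-left minima exactly
-- at the remaining indices of E, shifted by a.  Cutting at a₁, a₂, … in turn
-- gives the product decomposition.
module Submission where

open import Defs
open import Data.Nat using (ℕ; zero; suc; _+_; _∸_; _≤_; _<_; _≤?_; _<?_; _≟_; s≤s)
open import Data.Nat.Properties
open import Data.Fin using (Fin; toℕ; fromℕ<)
open import Data.Fin.Properties using (toℕ-injective; toℕ-fromℕ<; fromℕ<-toℕ; toℕ<n; injective⇒≤; any?)
open import Data.Vec using (Vec; lookup; tabulate)
open import Data.Vec.Properties using (lookup∘tabulate; tabulate∘lookup; tabulate-cong)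
open import Data.List using (List; []; _∷_; map)
open import Data.List.Properties using (map-id; map-cong; map-∘)
open import Data.List.Relation.Unary.All as All using (All; []; _∷_)
open import Data.List.Relation.Unary.All.Properties using (map⁺; map⁻)
open import Data.List.Relation.Unary.AllPairs using (AllPairs; []; _∷_)
open import Data.List.Relation.Unary.Linked.Properties using (Linked⇒AllPairs)
open import Data.Product using (∃; _×_; _,_; proj₁; proj₂)
open import Data.Product.Relation.Binary.Pointwise.NonDependent using (×-setoid)
open import Data.Product.Function.NonDependent.Setoid using (_×-bijection_)
open import Data.Sum using (_⊎_; inj₁; inj₂)
open import Data.Empty using (⊥; ⊥-elim)
open import Data.Unit using (tt)
open import Function using (_∘_)
open import Function.Bundles using (Bijection)
import Function.Construct.Identity as Identity
import Function.Construct.Composition as Composition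
open import Relation.Nullary using (yes; no)
open import Relation.Binary.PropositionalEquality
open import Relation.Binary.Definitions using (tri<; tri≈; tri>)

-- Permutations of size m are handled as functions ℕ → ℕ of which only the
-- values at 0 … m − 1 matter, so that cutting and gluing is plain arithmetic.

infix 4 _≗[_]_

_≗[_]_ : (ℕ → ℕ) → ℕ → (ℕ → ℕ) → Set
f ≗[ m ] g = ∀ k → k < m → f k ≡ g k

≗[]-sym : ∀ {m f g} → f ≗[ m ] g → g ≗[ m ] f
≗[]-sym f≗g k k<m = sym (f≗g k k<m)

≗[]-trans : ∀ {m f g h} → f ≗[ m ] g → g ≗[ m ] h → f ≗[ m ] h
≗[]-trans f≗g g≗h k k<m = trans (f≗g k k<m) (g≗h k k<m)

MapsBelow : ℕ → ℕ → (ℕ → ℕ) → Set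
MapsBelow m l f = ∀ i → i < m → f i < l

InjectiveOn : ℕ → (ℕ → ℕ) → Set
InjectiveOn m f = ∀ i j → i < m → j < m → f i ≡ f j → i ≡ j

Avoids213On : ℕ → (ℕ → ℕ) → Set
Avoids213On m f = ∀ i j k → i < j → j < k → k < m → f j < f i → f i < f k → ⊥

record Is213AvoidingOn (m : ℕ) (f : ℕ → ℕ) : Set where
  field
    bounded   : MapsBelow m m f
    injective : InjectiveOn m f
    avoids    : Avoids213On m f

IsRLMinOn : ℕ → (ℕ → ℕ) → ℕ → Set
IsRLMinOn m f c = ∀ i j → suc i ≡ c → i ≤ j → j < m → f i ≤ f j

Is213AvoidingOn-resp : ∀ {m f g} → f ≗[ m ] g → Is213AvoidingOn m f → Is213AvoidingOn m g
Is213AvoidingOn-resp {m} {f} {g} f≗g f-perm = record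
  { bounded   = λ i i<m → subst (_< m) (f≗g i i<m) (bounded i i<m)
  ; injective = λ i j i<m j<m gi≡gj →
      injective i j i<m j<m (trans (f≗g i i<m) (trans gi≡gj (sym (f≗g j j<m))))
  ; avoids    = λ i j k i<j j<k k<m gj<gi gi<gk →
      let j<m = <-trans j<k k<m ; i<m = <-trans i<j j<m in
      avoids i j k i<j j<k k<m
        (subst₂ _<_ (sym (f≗g j j<m)) (sym (f≗g i i<m)) gj<gi)
        (subst₂ _<_ (sym (f≗g i i<m)) (sym (f≗g k k<m)) gi<gk)
  }
  where open Is213AvoidingOn f-perm

IsRLMinOn-resp : ∀ {m f g c} → f ≗[ m ] g → IsRLMinOn m f c → IsRLMinOn m g c
IsRLMinOn-resp f≗g f-min i j si≡c i≤j j<m =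
  subst₂ _≤_ (f≗g i (≤-<-trans i≤j j<m)) (f≗g j j<m) (f-min i j si≡c i≤j j<m)

injectiveOn⇒≤ : ∀ {k l f} → MapsBelow k l f → InjectiveOn k f → k ≤ l
injectiveOn⇒≤ {k} {l} {f} f<l f-inj = injective⇒≤ {f = g} g-injective
  where
  g : Fin k → Fin l
  g i = fromℕ< (f<l (toℕ i) (toℕ<n i))

  g-injective : ∀ {i j} → g i ≡ g j → i ≡ j
  g-injective {i} {j} gi≡gj = toℕ-injective (f-inj _ _ (toℕ<n i) (toℕ<n j)
    (trans (sym (toℕ-fromℕ< _)) (trans (cong toℕ gi≡gj) (toℕ-fromℕ< _))))

injectiveOn-interval⇒≤ : ∀ {k lo hi f} → (∀ i → i < k → lo ≤ f i × f i < hi) →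
                         InjectiveOn k f → k ≤ hi ∸ lo
injectiveOn-interval⇒≤ in-range f-inj = injectiveOn⇒≤
  (λ i i<k → ∸-monoˡ-< (proj₂ (in-range i i<k)) (proj₁ (in-range i i<k)))
  (λ i j i<k j<k eq → f-inj i j i<k j<k
    (∸-cancelʳ-≡ (proj₁ (in-range i i<k)) (proj₁ (in-range j j<k)) eq))

injectiveOn⇒surjectiveOn : ∀ {m f} → MapsBelow m m f → InjectiveOn m f →
                           ∀ y → y < m → ∃ λ i → i < m × f i ≡ y
injectiveOn⇒surjectiveOn {m} {f} f<m f-inj y y<m with any? (λ (i : Fin m) → f (toℕ i) ≟ y)
... | yes (i , fi≡y) = toℕ i , toℕ<n i , fi≡y
... | no y∉image = ⊥-elim (1+n≰n (injectiveOn⇒≤ g<m g-injective))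
  where
  -- If y is missed, putting y in front of f injects m + 1 points into m.
  g : ℕ → ℕ
  g zero    = y
  g (suc i) = f i

  misses : ∀ i → i < m → f i ≢ y
  misses i i<m fi≡y = y∉image (fromℕ< i<m , trans (cong f (toℕ-fromℕ< i<m)) fi≡y)

  g<m : MapsBelow (suc m) m g
  g<m zero    _           = y<m
  g<m (suc i) (s≤s i<m) = f<m i i<m

  g-injective : InjectiveOn (suc m) g
  g-injective zero    zero    _           _           _     = refl
  g-injective zero    (suc j) _           (s≤s j<m) y≡fj  = ⊥-elim (misses j j<m (sym y≡fj))
  g-injective (suc i) zero    (s≤s i<m) _           fi≡y  = ⊥-elim (misses i i<m fi≡y)
  g-injective (suc i) (suc j) (s≤s i<m) (s≤s j<m) fi≡fj = cong suc (f-inj i j i<m j<m fi≡fj)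

-- Arguments outside 0 … m − 1 give the junk value 0.
_‼_ : ∀ {m} → Vec (Fin m) m → ℕ → ℕ
_‼_ {m} σ k with k <? m
... | yes k<m = toℕ (lookup σ (fromℕ< k<m))
... | no _    = 0

‼-fromℕ< : ∀ {m} (σ : Vec (Fin m) m) {k} (k<m : k < m) → σ ‼ k ≡ toℕ (lookup σ (fromℕ< k<m))
‼-fromℕ< {m} σ {k} k<m with k <? m
... | yes _   = refl
... | no k≮m = ⊥-elim (k≮m k<m)

‼-toℕ : ∀ {m} (σ : Vec (Fin m) m) (i : Fin m) → σ ‼ toℕ i ≡ toℕ (lookup σ i)
‼-toℕ σ i = trans (‼-fromℕ< σ (toℕ<n i)) (cong (toℕ ∘ lookup σ) (fromℕ<-toℕ i (toℕ<n i)))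

‼-bounded : ∀ {m} (σ : Vec (Fin m) m) → MapsBelow m m (σ ‼_)
‼-bounded σ k k<m = subst (_< _) (sym (‼-fromℕ< σ k<m)) (toℕ<n _)

‼-injective : ∀ {m} {σ σ′ : Vec (Fin m) m} → (σ ‼_) ≗[ m ] (σ′ ‼_) → σ ≡ σ′
‼-injective {σ = σ} {σ′} σ≗σ′ =
  trans (sym (tabulate∘lookup σ)) (trans (tabulate-cong lookup-≡) (tabulate∘lookup σ′))
  where
  lookup-≡ : ∀ i → lookup σ i ≡ lookup σ′ i
  lookup-≡ i = toℕ-injective
    (trans (sym (‼-toℕ σ i)) (trans (σ≗σ′ (toℕ i) (toℕ<n i)) (‼-toℕ σ′ i)))

tabulateOn : ∀ m (f : ℕ → ℕ) → MapsBelow m m f → Vec (Fin m) m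
tabulateOn m f f<m = tabulate (λ i → fromℕ< (f<m (toℕ i) (toℕ<n i)))

‼-tabulateOn : ∀ m f (f<m : MapsBelow m m f) → (tabulateOn m f f<m ‼_) ≗[ m ] f
‼-tabulateOn m f f<m k k<m =
  trans (‼-fromℕ< _ k<m)
    (trans (cong toℕ (lookup∘tabulate _ (fromℕ< k<m)))
      (trans (toℕ-fromℕ< _) (cong f (toℕ-fromℕ< k<m))))

Is213Avoiding⇒Is213AvoidingOn : ∀ {m} (σ : Vec (Fin m) m) → Is213Avoiding σ → Is213AvoidingOn m (σ ‼_)
Is213Avoiding⇒Is213AvoidingOn {m} σ (σ-perm , σ-avoids) = record
  { bounded   = ‼-bounded σ
  ; injective = λ i j i<m j<m σi≡σj →
      trans (sym (toℕ-fromℕ< i<m)) (trans (cong toℕ (σ-perm _ _ (toℕ-injective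
        (trans (sym (‼-fromℕ< σ i<m)) (trans σi≡σj (‼-fromℕ< σ j<m)))))) (toℕ-fromℕ< j<m))
  ; avoids    = λ i j k i<j j<k k<m σj<σi σi<σk →
      let j<m = <-trans j<k k<m ; i<m = <-trans i<j j<m in
      σ-avoids (fromℕ< i<m , fromℕ< j<m , fromℕ< k<m ,
        subst₂ _<_ (sym (toℕ-fromℕ< i<m)) (sym (toℕ-fromℕ< j<m)) i<j ,
        subst₂ _<_ (sym (toℕ-fromℕ< j<m)) (sym (toℕ-fromℕ< k<m)) j<k ,
        subst₂ _<_ (‼-fromℕ< σ j<m) (‼-fromℕ< σ i<m) σj<σi ,
        subst₂ _<_ (‼-fromℕ< σ i<m) (‼-fromℕ< σ k<m) σi<σk)
  }

Is213AvoidingOn⇒Is213Avoiding : ∀ {m} (σ : Vec (Fin m) m) → Is213AvoidingOn m (σ ‼_) → Is213Avoiding σ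
Is213AvoidingOn⇒Is213Avoiding {m} σ σ-perm = σ-injective , σ-avoids
  where
  open Is213AvoidingOn σ-perm

  σ-injective : IsPerm σ
  σ-injective i j σi≡σj = toℕ-injective (injective _ _ (toℕ<n i) (toℕ<n j)
    (trans (‼-toℕ σ i) (trans (cong toℕ σi≡σj) (sym (‼-toℕ σ j)))))

  σ-avoids : Avoids213 σ
  σ-avoids (i₁ , i₂ , i₃ , i₁<i₂ , i₂<i₃ , σi₂<σi₁ , σi₁<σi₃) =
    avoids (toℕ i₁) (toℕ i₂) (toℕ i₃) i₁<i₂ i₂<i₃ (toℕ<n i₃)
      (subst₂ _<_ (sym (‼-toℕ σ i₂)) (sym (‼-toℕ σ i₁)) σi₂<σi₁)
      (subst₂ _<_ (sym (‼-toℕ σ i₁)) (sym (‼-toℕ σ i₃)) σi₁<σi₃)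

IsRLMinAt⇒IsRLMinOn : ∀ {m} (σ : Vec (Fin m) m) {c} → IsRLMinAt σ c → IsRLMinOn m (σ ‼_) c
IsRLMinAt⇒IsRLMinOn σ σ-min i j si≡c i≤j j<m =
  let i<m = ≤-<-trans i≤j j<m in
  subst₂ _≤_ (sym (‼-fromℕ< σ i<m)) (sym (‼-fromℕ< σ j<m))
    (σ-min (fromℕ< i<m) (fromℕ< j<m) (trans (cong suc (toℕ-fromℕ< i<m)) si≡c)
      (subst₂ _≤_ (sym (toℕ-fromℕ< i<m)) (sym (toℕ-fromℕ< j<m)) i≤j))

IsRLMinOn⇒IsRLMinAt : ∀ {m} (σ : Vec (Fin m) m) {c} → IsRLMinOn m (σ ‼_) c → IsRLMinAt σ c
IsRLMinOn⇒IsRLMinAt σ σ-min i j si≡c i≤j =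
  subst₂ _≤_ (‼-toℕ σ i) (‼-toℕ σ j) (σ-min (toℕ i) (toℕ j) si≡c i≤j (toℕ<n j))

fromFun : ∀ m f → Is213AvoidingOn m f → 𝒫 m
fromFun m f f-perm = tabulateOn m f bounded ,
  Is213AvoidingOn⇒Is213Avoiding _ (Is213AvoidingOn-resp (≗[]-sym (‼-tabulateOn m f bounded)) f-perm)
  where open Is213AvoidingOn f-perm

‼-fromFun : ∀ m f (f-perm : Is213AvoidingOn m f) → (proj₁ (fromFun m f f-perm) ‼_) ≗[ m ] f
‼-fromFun m f f-perm = ‼-tabulateOn m f (Is213AvoidingOn.bounded f-perm)

fromFunE : ∀ m f {E} → Is213AvoidingOn m f → All (IsRLMinOn m f) E → 𝒫E m E
fromFunE m f f-perm f-mins = proj₁ (fromFun m f f-perm) , proj₂ (fromFun m f f-perm) ,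
  All.map (IsRLMinOn⇒IsRLMinAt _ ∘ IsRLMinOn-resp (≗[]-sym (‼-fromFun m f f-perm))) f-mins

∸-<-bound : ∀ {a q c} → a ≤ q → q < a + c → q ∸ a < c
∸-<-bound {a} {q} {c} a≤q q<a+c = subst (q ∸ a <_) (m+n∸m≡n a c) (∸-monoˡ-< q<a+c a≤q)

module _ {g : ℕ → ℕ} (g-mono : ∀ {x y} → x < y → g x < g y) where

  strictMono⇒injective : ∀ {x y} → g x ≡ g y → x ≡ y
  strictMono⇒injective {x} {y} gx≡gy with <-cmp x y
  ... | tri< x<y _ _ = ⊥-elim (<⇒≢ (g-mono x<y) gx≡gy)
  ... | tri≈ _ x≡y _ = x≡y
  ... | tri> _ _ y<x = ⊥-elim (<⇒≢ (g-mono y<x) (sym gx≡gy))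

  strictMono⇒reflects-< : ∀ {x y} → g x < g y → x < y
  strictMono⇒reflects-< {x} {y} gx<gy with <-cmp x y
  ... | tri< x<y _ _   = x<y
  ... | tri≈ _ refl _ = ⊥-elim (<-irrefl refl gx<gy)
  ... | tri> _ _ y<x   = ⊥-elim (<-asym gx<gy (g-mono y<x))

-- The suffix of a split permutation occupies the block v + 1, …, v + b,
-- where v is the value at the cut.
OutsideGap : ℕ → ℕ → ℕ → Set
OutsideGap v b x = x ≤ v ⊎ v + b < x

InsideGap : ℕ → ℕ → ℕ → Set
InsideGap v b x = v < x × x ≤ v + b

openGap : ℕ → ℕ → ℕ → ℕ
openGap v b x with x ≤? v
... | yes _ = x
... | no _  = x + b

closeGap : ℕ → ℕ → ℕ → ℕ
closeGap v b x with x ≤? v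
... | yes _ = x
... | no _  = x ∸ b

openGap-≤ : ∀ {v b x} → x ≤ v → openGap v b x ≡ x
openGap-≤ {v} {b} {x} x≤v with x ≤? v
... | yes _   = refl
... | no x≰v = ⊥-elim (x≰v x≤v)

openGap-> : ∀ {v b x} → v < x → openGap v b x ≡ x + b
openGap-> {v} {b} {x} v<x with x ≤? v
... | yes x≤v = ⊥-elim (<⇒≱ v<x x≤v)
... | no _    = refl

closeGap-≤ : ∀ {v b x} → x ≤ v → closeGap v b x ≡ x
closeGap-≤ {v} {b} {x} x≤v with x ≤? v
... | yes _   = refl
... | no x≰v = ⊥-elim (x≰v x≤v)

closeGap-> : ∀ {v b x} → v < x → closeGap v b x ≡ x ∸ b
closeGap-> {v} {b} {x} v<x with x ≤? v
... | yes x≤v = ⊥-elim (<⇒≱ v<x x≤v)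
... | no _    = refl

openGap-outside : ∀ v b x → OutsideGap v b (openGap v b x)
openGap-outside v b x with x ≤? v
... | yes x≤v = inj₁ x≤v
... | no x≰v  = inj₂ (+-monoˡ-< b (≰⇒> x≰v))

openGap-inflationary : ∀ v b x → x ≤ openGap v b x
openGap-inflationary v b x with x ≤? v
... | yes _ = ≤-refl
... | no _  = m≤m+n x b

openGap-strictMono : ∀ {v b x y} → x < y → openGap v b x < openGap v b y
openGap-strictMono {v} {b} {x} {y} x<y with x ≤? v | y ≤? v
... | yes _   | yes _   = x<y
... | yes _   | no _    = ≤-trans x<y (m≤m+n y b)
... | no x≰v | yes y≤v = ⊥-elim (x≰v (≤-trans (<⇒≤ x<y) y≤v))
... | no _    | no _    = +-monoˡ-< b x<y

openGap-injective : ∀ {v b x y} → openGap v b x ≡ openGap v b y → x ≡ y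
openGap-injective = strictMono⇒injective openGap-strictMono

openGap-reflects-< : ∀ {v b x y} → openGap v b x < openGap v b y → x < y
openGap-reflects-< = strictMono⇒reflects-< openGap-strictMono

openGap-bounded : ∀ {v b x a} → x < a → openGap v b x < a + b
openGap-bounded {v} {b} {x} {a} x<a with x ≤? v
... | yes _ = <-≤-trans x<a (m≤m+n a b)
... | no _  = +-monoˡ-< b x<a

closeGap-openGap : ∀ v b x → closeGap v b (openGap v b x) ≡ x
closeGap-openGap v b x with x ≤? v
... | yes x≤v = closeGap-≤ x≤v
... | no x≰v  = trans (closeGap-> (<-≤-trans (≰⇒> x≰v) (m≤m+n x b))) (m+n∸n≡m x b)

openGap-closeGap : ∀ {v b x} → OutsideGap v b x → openGap v b (closeGap v b x) ≡ x
openGap-closeGap {v} {b} {x} (inj₁ x≤v) = trans (cong (openGap v b) (closeGap-≤ x≤v)) (openGap-≤ x≤v)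
openGap-closeGap {v} {b} {x} (inj₂ v+b<x) =
  trans (cong (openGap v b) (closeGap-> (≤-<-trans (m≤m+n v b) v+b<x)))
    (trans (openGap-> v<x∸b) (m∸n+n≡m b≤x))
  where
  b≤x : b ≤ x
  b≤x = ≤-trans (m≤n+m b v) (<⇒≤ v+b<x)

  v<x∸b : v < x ∸ b
  v<x∸b = +-cancelʳ-< b v (x ∸ b) (subst (v + b <_) (sym (m∸n+n≡m b≤x)) v+b<x)

closeGap-injective : ∀ {v b x y} → OutsideGap v b x → OutsideGap v b y →
                     closeGap v b x ≡ closeGap v b y → x ≡ y
closeGap-injective {v} {b} x-out y-out eq =
  trans (sym (openGap-closeGap x-out)) (trans (cong (openGap v b) eq) (openGap-closeGap y-out))

closeGap-reflects-< : ∀ {v b x y} → OutsideGap v b x → OutsideGap v b y →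
                      closeGap v b x < closeGap v b y → x < y
closeGap-reflects-< x-out y-out lt =
  subst₂ _<_ (openGap-closeGap x-out) (openGap-closeGap y-out) (openGap-strictMono lt)

closeGap-bounded : ∀ {v b x a} → v < a → x < a + b → OutsideGap v b x → closeGap v b x < a
closeGap-bounded v<a x<a+b (inj₁ x≤v) = subst (_< _) (sym (closeGap-≤ x≤v)) (≤-<-trans x≤v v<a)
closeGap-bounded {v} {b} {x} {a} v<a x<a+b (inj₂ v+b<x) =
  subst (_< a) (sym (closeGap-> (≤-<-trans (m≤m+n v b) v+b<x)))
    (∸-<-bound (≤-trans (m≤n+m b v) (<⇒≤ v+b<x)) (subst (x <_) (+-comm a b) x<a+b))

outside≢inside : ∀ {v b x y} → OutsideGap v b x → InsideGap v b y → x ≢ y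
outside≢inside (inj₁ x≤v)   (v<y , _)   refl = <⇒≱ v<y x≤v
outside≢inside (inj₂ v+b<x) (_ , y≤v+b) refl = <⇒≱ v+b<x y≤v+b

outside-between-inside : ∀ {v b x y z} → OutsideGap v b x → InsideGap v b y → InsideGap v b z →
                         y < x → x < z → ⊥
outside-between-inside (inj₁ x≤v)   (v<y , _) _           y<x _   = <⇒≱ (<-trans v<y y<x) x≤v
outside-between-inside (inj₂ v+b<x) _         (_ , z≤v+b) _   x<z = <⇒≱ (<-trans v+b<x x<z) z≤v+b

outside-below-inside : ∀ {v b x y} → OutsideGap v b x → InsideGap v b y → x < y → x ≤ v
outside-below-inside (inj₁ x≤v)   _           _   = x≤v
outside-below-inside (inj₂ v+b<x) (_ , y≤v+b) x<y = ⊥-elim (<⇒≱ (<-trans v+b<x x<y) y≤v+b)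

-- The cut is after 0-based position p, i.e. at the 1-based index suc p, and b
-- is the length of the suffix.
splitHead : ℕ → ℕ → (ℕ → ℕ) → ℕ → ℕ
splitHead p b f k = closeGap (f p) b (f k)

splitTail : ℕ → ℕ → (ℕ → ℕ) → ℕ → ℕ
splitTail p b f k = f (suc p + k) ∸ suc (f p)

glue : ℕ → ℕ → (ℕ → ℕ) → (ℕ → ℕ) → ℕ → ℕ
glue p b t r k with k <? suc p
... | yes _ = openGap (t p) b (t k)
... | no _  = suc (t p) + r (k ∸ suc p)

data HeadOrTail (a : ℕ) : ℕ → Set where
  head : ∀ {k} → k < a → HeadOrTail a k
  tail : ∀ k → HeadOrTail a (a + k)

headOrTail : ∀ a k → HeadOrTail a k
headOrTail a k with k <? a
... | yes k<a = head k<a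
... | no k≮a  = subst (HeadOrTail a) (m+[n∸m]≡n (≮⇒≥ k≮a)) (tail (k ∸ a))

glue-head : ∀ p b t r {k} → k < suc p → glue p b t r k ≡ openGap (t p) b (t k)
glue-head p b t r {k} k≤p with k <? suc p
... | yes _   = refl
... | no k≰p = ⊥-elim (k≰p k≤p)

glue-tail : ∀ p b t r k → glue p b t r (suc p + k) ≡ suc (t p) + r k
glue-tail p b t r k with suc p + k <? suc p
... | yes tail<sp = ⊥-elim (<⇒≱ tail<sp (m≤m+n (suc p) k))
... | no _        = cong (λ i → suc (t p) + r i) (m+n∸m≡n (suc p) k)

glue-pivot : ∀ p b t r → glue p b t r p ≡ t p
glue-pivot p b t r = trans (glue-head p b t r (n<1+n p)) (openGap-≤ ≤-refl)

splitHead-cong : ∀ {p b f g} → f ≗[ suc p + b ] g → splitHead p b f ≗[ suc p ] splitHead p b g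
splitHead-cong {p} {b} f≗g k k≤p =
  cong₂ (λ v x → closeGap v b x) (f≗g p (m≤m+n (suc p) b)) (f≗g k (<-≤-trans k≤p (m≤m+n (suc p) b)))

splitTail-cong : ∀ {p b f g} → f ≗[ suc p + b ] g → splitTail p b f ≗[ b ] splitTail p b g
splitTail-cong {p} {b} f≗g k k<b =
  cong₂ (λ x v → x ∸ suc v) (f≗g _ (+-monoʳ-< (suc p) k<b)) (f≗g p (m≤m+n (suc p) b))

glue-cong : ∀ {p b t t′ r r′} → t ≗[ suc p ] t′ → r ≗[ b ] r′ →
            glue p b t r ≗[ suc p + b ] glue p b t′ r′
glue-cong {p} {b} {t} {t′} {r} {r′} t≗t′ r≗r′ k k<n with headOrTail (suc p) k
... | head k≤p = trans (glue-head p b t r k≤p) (trans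
      (cong₂ (λ v x → openGap v b x) (t≗t′ p (n<1+n p)) (t≗t′ k k≤p)) (sym (glue-head p b t′ r′ k≤p)))
... | tail k   = trans (glue-tail p b t r k) (trans
      (cong₂ (λ v x → suc v + x) (t≗t′ p (n<1+n p)) (r≗r′ k (+-cancelˡ-< (suc p) k b k<n)))
      (sym (glue-tail p b t′ r′ k)))

module Split {p b : ℕ} {f : ℕ → ℕ} (f-perm : Is213AvoidingOn (suc p + b) f)
             (pivot-min : IsRLMinOn (suc p + b) f (suc p)) where

  open Is213AvoidingOn f-perm

  head<n : ∀ {k} → k < suc p → k < suc p + b
  head<n k≤p = <-≤-trans k≤p (m≤m+n (suc p) b)

  tail<n : ∀ {k} → k < b → suc p + k < suc p + b
  tail<n = +-monoʳ-< (suc p)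

  pivot<tail : ∀ k → k < b → f p < f (suc p + k)
  pivot<tail k k<b = ≤∧≢⇒<
    (pivot-min p (suc p + k) refl (≤-trans (n≤1+n p) (m≤m+n (suc p) k)) (tail<n k<b))
    (λ fp≡ft → <⇒≢ (m≤m+n (suc p) k) (injective p (suc p + k) (head<n (n<1+n p)) (tail<n k<b) fp≡ft))

  tail-value : ∀ k → k < b → f (suc p + k) ≡ suc (f p) + splitTail p b f k
  tail-value k k<b = sym (m+[n∸m]≡n (pivot<tail k k<b))

  high-above-tail : ∀ i k → i < p → k < b → f p < f i → f (suc p + k) < f i
  high-above-tail i k i<p k<b fp<fi with <-cmp (f i) (f (suc p + k))
  ... | tri< fi<ft _ _ = ⊥-elim (avoids i p (suc p + k) i<p (m≤m+n (suc p) k) (tail<n k<b) fp<fi fi<ft)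
  ... | tri≈ _ fi≡ft _ = ⊥-elim (<⇒≢ (<-trans i<p (m≤m+n (suc p) k))
                           (injective i (suc p + k) (head<n (<-trans i<p (n<1+n p))) (tail<n k<b) fi≡ft))
  ... | tri> _ _ ft<fi = ft<fi

  -- The suc b entries from position p on are distinct and at least f p.
  pivot≤p : f p ≤ p
  pivot≤p = ≮⇒≥ λ p<fp → 1+n≰n (≤-trans count
    (≤-trans (∸-monoʳ-≤ (suc p + b) p<fp) (≤-reflexive (m+n∸m≡n (suc p) b))))
    where
    p+k<n : ∀ {k} → k < suc b → p + k < suc p + b
    p+k<n {k} k≤b = subst (p + k <_) (+-suc p b) (+-monoʳ-< p k≤b)

    count : suc b ≤ suc p + b ∸ f p
    count = injectiveOn-interval⇒≤ {f = λ k → f (p + k)}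
      (λ k k≤b → pivot-min p (p + k) refl (m≤m+n p k) (p+k<n k≤b) , bounded (p + k) (p+k<n k≤b))
      (λ i j i≤b j≤b eq → +-cancelˡ-≡ p i j (injective _ _ (p+k<n i≤b) (p+k<n j≤b) eq))

  -- The b entries after p are distinct and lie strictly between f p and f i.
  high-above-gap : ∀ i → i < p → f p < f i → f p + b < f i
  high-above-gap i i<p fp<fi = ≰⇒> λ fi≤fp+b →
    <⇒≱ (∸-<-bound fp<fi (s≤s fi≤fp+b)) count
    where
    count : b ≤ f i ∸ suc (f p)
    count = injectiveOn-interval⇒≤ {f = λ k → f (suc p + k)}
      (λ k k<b → pivot<tail k k<b , high-above-tail i k i<p k<b fp<fi)
      (λ j k j<b k<b eq → +-cancelˡ-≡ (suc p) j k (injective _ _ (tail<n j<b) (tail<n k<b) eq))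

  head-outside : ∀ k → k < suc p → OutsideGap (f p) b (f k)
  head-outside k k≤p with m<1+n⇒m<n∨m≡n k≤p
  ... | inj₂ refl = inj₁ ≤-refl
  ... | inj₁ k<p with f k ≤? f p
  ...   | yes fk≤fp = inj₁ fk≤fp
  ...   | no fk≰fp  = inj₂ (high-above-gap k k<p (≰⇒> fk≰fp))

  head-perm : Is213AvoidingOn (suc p) (splitHead p b f)
  head-perm = record
    { bounded   = λ k k≤p → closeGap-bounded (s≤s pivot≤p) (bounded k (head<n k≤p)) (head-outside k k≤p)
    ; injective = λ i j i≤p j≤p eq → injective i j (head<n i≤p) (head<n j≤p)
        (closeGap-injective (head-outside i i≤p) (head-outside j j≤p) eq)
    ; avoids    = λ i j k i<j j<k k≤p hj<hi hi<hk →
        let j≤p = <-trans j<k k≤p ; i≤p = <-trans i<j j≤p in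
        avoids i j k i<j j<k (head<n k≤p)
          (closeGap-reflects-< (head-outside j j≤p) (head-outside i i≤p) hj<hi)
          (closeGap-reflects-< (head-outside i i≤p) (head-outside k k≤p) hi<hk)
    }

  -- A suffix value above the block would, with the gap closed, be hit by the
  -- head, which is a permutation of 0 … p.
  tail-not-above-gap : ∀ k → k < b → f p + b < f (suc p + k) → ⊥
  tail-not-above-gap k k<b above
    with injectiveOn⇒surjectiveOn (Is213AvoidingOn.bounded head-perm) (Is213AvoidingOn.injective head-perm)
           _ (closeGap-bounded (s≤s pivot≤p) (bounded _ (tail<n k<b)) (inj₂ above))
  ... | i , i≤p , head-i≡ = <⇒≢ (<-≤-trans i≤p (m≤m+n (suc p) k))
        (injective i (suc p + k) (head<n i≤p) (tail<n k<b)
          (closeGap-injective (head-outside i i≤p) (inj₂ above) head-i≡))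

  tail-perm : Is213AvoidingOn b (splitTail p b f)
  tail-perm = record
    { bounded   = λ k k<b → ∸-<-bound (pivot<tail k k<b) (s≤s (≮⇒≥ (tail-not-above-gap k k<b)))
    ; injective = λ i j i<b j<b eq → +-cancelˡ-≡ (suc p) i j (injective _ _ (tail<n i<b) (tail<n j<b)
        (trans (tail-value i i<b) (trans (cong (suc (f p) +_) eq) (sym (tail-value j j<b)))))
    ; avoids    = λ i j k i<j j<k k<b tj<ti ti<tk →
        let j<b = <-trans j<k k<b ; i<b = <-trans i<j j<b in
        avoids (suc p + i) (suc p + j) (suc p + k)
          (+-monoʳ-< (suc p) i<j) (+-monoʳ-< (suc p) j<k) (tail<n k<b)
          (subst₂ _<_ (sym (tail-value j j<b)) (sym (tail-value i i<b)) (+-monoʳ-< (suc (f p)) tj<ti))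
          (subst₂ _<_ (sym (tail-value i i<b)) (sym (tail-value k k<b)) (+-monoʳ-< (suc (f p)) ti<tk))
    }

  tail-min : ∀ c → suc p < c → IsRLMinOn (suc p + b) f c → IsRLMinOn b (splitTail p b f) (c ∸ suc p)
  tail-min c p<c c-min i j si≡c i≤j j<b = ∸-monoˡ-≤ (suc (f p))
    (c-min (suc p + i) (suc p + j) index (+-monoʳ-≤ (suc p) i≤j) (tail<n j<b))
    where
    index : suc (suc p + i) ≡ c
    index = trans (sym (+-suc (suc p) i)) (trans (cong (suc p +_) si≡c) (m+[n∸m]≡n (<⇒≤ p<c)))

  glue-split : glue p b (splitHead p b f) (splitTail p b f) ≗[ suc p + b ] f
  glue-split k k<n with headOrTail (suc p) k
  ... | head k≤p = trans (glue-head p b _ _ k≤p)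
        (trans (cong (λ v → openGap v b (splitHead p b f k)) (closeGap-≤ ≤-refl))
          (openGap-closeGap (head-outside k k≤p)))
  ... | tail k   = trans (glue-tail p b _ _ k)
        (trans (cong (λ v → suc v + splitTail p b f k) (closeGap-≤ ≤-refl))
          (sym (tail-value k (+-cancelˡ-< (suc p) k b k<n))))

module Glue {p b : ℕ} {t r : ℕ → ℕ} (t-perm : Is213AvoidingOn (suc p) t)
            (r-perm : Is213AvoidingOn b r) where

  private
    module T = Is213AvoidingOn t-perm
    module R = Is213AvoidingOn r-perm

  σ : ℕ → ℕ
  σ = glue p b t r

  σ-head : ∀ {k} → k < suc p → σ k ≡ openGap (t p) b (t k)
  σ-head = glue-head p b t r

  σ-tail : ∀ k → σ (suc p + k) ≡ suc (t p) + r k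
  σ-tail = glue-tail p b t r

  tail<b : ∀ {k} → suc p + k < suc p + b → k < b
  tail<b {k} = +-cancelˡ-< (suc p) k b

  head-outside : ∀ {k} → k < suc p → OutsideGap (t p) b (σ k)
  head-outside {k} k≤p = subst (OutsideGap (t p) b) (sym (σ-head k≤p)) (openGap-outside (t p) b (t k))

  tail-inside : ∀ {k} → k < b → InsideGap (t p) b (σ (suc p + k))
  tail-inside {k} k<b = subst (InsideGap (t p) b) (sym (σ-tail k))
    (s≤s (m≤m+n (t p) (r k)) , +-monoʳ-< (t p) (R.bounded k k<b))

  head-reflects-< : ∀ {i j} → i < suc p → j < suc p → σ i < σ j → t i < t j
  head-reflects-< i≤p j≤p σi<σj = openGap-reflects-< (subst₂ _<_ (σ-head i≤p) (σ-head j≤p) σi<σj)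

  tail-reflects-< : ∀ i j → σ (suc p + i) < σ (suc p + j) → r i < r j
  tail-reflects-< i j σi<σj = +-cancelˡ-< (suc (t p)) (r i) (r j) (subst₂ _<_ (σ-tail i) (σ-tail j) σi<σj)

  glue-bounded : MapsBelow (suc p + b) (suc p + b) σ
  glue-bounded k k<n with headOrTail (suc p) k
  ... | head k≤p = subst (_< suc p + b) (sym (σ-head k≤p))
                     (openGap-bounded (T.bounded k k≤p))
  ... | tail k   = ≤-<-trans (proj₂ (tail-inside (tail<b k<n))) (+-monoˡ-< b (T.bounded p (n<1+n p)))

  glue-injective : InjectiveOn (suc p + b) σ
  glue-injective i j i<n j<n σi≡σj with headOrTail (suc p) i | headOrTail (suc p) j
  ... | head i≤p | head j≤p = T.injective i j i≤p j≤p
        (openGap-injective (trans (sym (σ-head i≤p)) (trans σi≡σj (σ-head j≤p))))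
  ... | head i≤p | tail j′  = ⊥-elim (outside≢inside (head-outside i≤p) (tail-inside (tail<b j<n)) σi≡σj)
  ... | tail i′  | head j≤p = ⊥-elim (outside≢inside (head-outside j≤p) (tail-inside (tail<b i<n)) (sym σi≡σj))
  ... | tail i′  | tail j′  = cong (suc p +_) (R.injective i′ j′ (tail<b i<n) (tail<b j<n)
        (+-cancelˡ-≡ (suc (t p)) (r i′) (r j′) (trans (sym (σ-tail i′)) (trans σi≡σj (σ-tail j′)))))

  -- Here σ i lies below the block, so t i ≤ t p, and t j < t i ≤ t p is a 213
  -- at positions i, j, p of t unless j = p.
  head-head-below : ∀ {i j} → i < j → j < suc p → σ j < σ i → σ i ≤ t p → ⊥
  head-head-below {i} {j} i<j j≤p σj<σi σi≤tp = below (m<1+n⇒m<n∨m≡n j≤p)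
    where
    i≤p : i < suc p
    i≤p = <-trans i<j j≤p

    tj<ti : t j < t i
    tj<ti = head-reflects-< j≤p i≤p σj<σi

    ti≤tp : t i ≤ t p
    ti≤tp = ≤-trans (openGap-inflationary (t p) b (t i)) (subst (_≤ t p) (σ-head i≤p) σi≤tp)

    below : j < p ⊎ j ≡ p → ⊥
    below (inj₁ j<p) = T.avoids i j p i<j j<p (n<1+n p) tj<ti
      (≤∧≢⇒< ti≤tp (<⇒≢ (<-trans i<j j<p) ∘ T.injective i p i≤p (n<1+n p)))
    below (inj₂ j≡p) = <⇒≱ (subst (λ x → t x < t i) j≡p tj<ti) ti≤tp

  glue-avoids : Avoids213On (suc p + b) σ
  glue-avoids i j k i<j j<k k<n σj<σi σi<σk with headOrTail (suc p) k
  ... | head k≤p = T.avoids i j k i<j j<k k≤p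
        (head-reflects-< (<-trans j<k k≤p) (<-trans (<-trans i<j j<k) k≤p) σj<σi)
        (head-reflects-< (<-trans (<-trans i<j j<k) k≤p) k≤p σi<σk)
  ... | tail k′ with headOrTail (suc p) j
  ...   | head j≤p = head-head-below i<j j≤p σj<σi
          (outside-below-inside (head-outside (<-trans i<j j≤p)) (tail-inside (tail<b k<n)) σi<σk)
  ...   | tail j′ with headOrTail (suc p) i
  ...     | head i≤p = outside-between-inside (head-outside i≤p)
            (tail-inside (tail<b (<-trans j<k k<n))) (tail-inside (tail<b k<n)) σj<σi σi<σk
  ...     | tail i′  = R.avoids i′ j′ k′ (+-cancelˡ-< (suc p) i′ j′ i<j) (+-cancelˡ-< (suc p) j′ k′ j<k)
            (tail<b k<n) (tail-reflects-< j′ i′ σj<σi) (tail-reflects-< i′ k′ σi<σk)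

  glue-perm : Is213AvoidingOn (suc p + b) σ
  glue-perm = record { bounded = glue-bounded ; injective = glue-injective ; avoids = glue-avoids }

  glue-pivot-min : IsRLMinOn (suc p + b) σ (suc p)
  glue-pivot-min i j si≡sp i≤j j<n with suc-injective si≡sp
  ... | refl with headOrTail (suc p) j
  ...   | head j≤p = ≤-reflexive (cong σ (≤-antisym i≤j (≤-pred j≤p)))
  ...   | tail j′  = subst (_≤ σ (suc p + j′)) (sym (glue-pivot p b t r))
                       (<⇒≤ (proj₁ (tail-inside (tail<b j<n))))

  glue-min : ∀ c → suc p < c → IsRLMinOn b r (c ∸ suc p) → IsRLMinOn (suc p + b) σ c
  glue-min c p<c c-min i j si≡c i≤j j<n with headOrTail (suc p) i | headOrTail (suc p) j
  ... | head i≤p | _        = ⊥-elim (<⇒≱ p<c (subst (_≤ suc p) si≡c i≤p))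
  ... | tail i′  | head j≤p = ⊥-elim (<⇒≱ (<-≤-trans j≤p (m≤m+n (suc p) i′)) i≤j)
  ... | tail i′  | tail j′  = subst₂ _≤_ (sym (σ-tail i′)) (sym (σ-tail j′)) (+-monoʳ-≤ (suc (t p))
        (c-min i′ j′ index (+-cancelˡ-≤ (suc p) i′ j′ i≤j) (tail<b j<n)))
    where
    index : suc i′ ≡ c ∸ suc p
    index = trans (sym (m+n∸m≡n (suc p) (suc i′))) (cong (_∸ suc p) (trans (+-suc (suc p) i′) si≡c))

  splitHead-glue : splitHead p b σ ≗[ suc p ] t
  splitHead-glue k k≤p = trans (cong₂ (λ v x → closeGap v b x) (glue-pivot p b t r) (σ-head k≤p))
    (closeGap-openGap (t p) b (t k))

  splitTail-glue : splitTail p b σ ≗[ b ] r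
  splitTail-glue k _ = trans (cong₂ (λ x v → x ∸ suc v) (σ-tail k) (glue-pivot p b t r))
    (m+n∸m≡n (suc (t p)) (r k))

module Cut (p b : ℕ) (cs : List ℕ) (cs-after : All (suc p <_) cs) where

  Pieces : Set
  Pieces = 𝒫 (suc p) × 𝒫E b (map (_∸ suc p) cs)

  _≈ᴾ_ : Pieces → Pieces → Set
  u ≈ᴾ v = proj₁ (proj₁ u) ≡ proj₁ (proj₁ v) × proj₁ (proj₂ u) ≡ proj₁ (proj₂ v)

  split : 𝒫E (suc p + b) (suc p ∷ cs) → Pieces
  split (σ , σ-perm , pivot-min ∷ cs-min) =
    fromFun (suc p) (splitHead p b (σ ‼_)) head-perm ,
    fromFunE b (splitTail p b (σ ‼_)) tail-perm (map⁺ (All.zipWith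
      (λ (p<c , c-min) → tail-min _ p<c (IsRLMinAt⇒IsRLMinOn σ c-min)) (cs-after , cs-min)))
    where open Split (Is213Avoiding⇒Is213AvoidingOn σ σ-perm) (IsRLMinAt⇒IsRLMinOn σ pivot-min)

  join : Pieces → 𝒫E (suc p + b) (suc p ∷ cs)
  join ((τ , τ-perm) , ρ , ρ-perm , ρ-mins) =
    fromFunE (suc p + b) (glue p b (τ ‼_) (ρ ‼_)) glue-perm (glue-pivot-min ∷ All.zipWith
      (λ (p<c , c-min) → glue-min _ p<c (IsRLMinAt⇒IsRLMinOn ρ c-min)) (cs-after , map⁻ ρ-mins))
    where open Glue (Is213Avoiding⇒Is213AvoidingOn τ τ-perm) (Is213Avoiding⇒Is213AvoidingOn ρ ρ-perm)

  ‼-split : ∀ x → (proj₁ x ‼_) ≗[ suc p + b ]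
                  glue p b (proj₁ (proj₁ (split x)) ‼_) (proj₁ (proj₂ (split x)) ‼_)
  ‼-split (σ , σ-perm , pivot-min ∷ _) = ≗[]-trans (≗[]-sym glue-split)
    (glue-cong (≗[]-sym (‼-fromFun _ _ head-perm)) (≗[]-sym (‼-fromFun _ _ tail-perm)))
    where open Split (Is213Avoiding⇒Is213AvoidingOn σ σ-perm) (IsRLMinAt⇒IsRLMinOn σ pivot-min)

  split-cong : ∀ {x y} → proj₁ x ≡ proj₁ y → split x ≈ᴾ split y
  split-cong {σ , _ , _ ∷ _} {.σ , _ , _ ∷ _} refl = refl , refl

  split-injective : ∀ {x y} → split x ≈ᴾ split y → proj₁ x ≡ proj₁ y
  split-injective {x} {y} (τ≡ , ρ≡) = ‼-injective (≗[]-trans (‼-split x) (≗[]-trans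
    (λ k _ → cong₂ (λ τ ρ → glue p b (τ ‼_) (ρ ‼_) k) τ≡ ρ≡) (≗[]-sym (‼-split y))))

  split-join : ∀ y z → proj₁ z ≡ proj₁ (join y) → split z ≈ᴾ y
  split-join ((τ , τ-perm) , ρ , ρ-perm , _) (σ , σ-perm , pivot-min ∷ _) σ≡ =
    ‼-injective (≗[]-trans (‼-fromFun _ _ S.head-perm) (≗[]-trans (splitHead-cong σ≗glue) G.splitHead-glue)) ,
    ‼-injective (≗[]-trans (‼-fromFun _ _ S.tail-perm) (≗[]-trans (splitTail-cong σ≗glue) G.splitTail-glue))
    where
    module S = Split (Is213Avoiding⇒Is213AvoidingOn σ σ-perm) (IsRLMinAt⇒IsRLMinOn σ pivot-min)
    module G = Glue (Is213Avoiding⇒Is213AvoidingOn τ τ-perm) (Is213Avoiding⇒Is213AvoidingOn ρ ρ-perm)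

    σ≗glue : (σ ‼_) ≗[ suc p + b ] glue p b (τ ‼_) (ρ ‼_)
    σ≗glue k k<n = trans (cong (_‼ k) σ≡) (‼-fromFun _ _ G.glue-perm k k<n)

  split-bijection : Bijection (𝒫E-setoid (suc p + b) (suc p ∷ cs))
                              (×-setoid (𝒫-setoid (suc p)) (𝒫E-setoid b (map (_∸ suc p) cs)))
  split-bijection = record
    { to        = split
    ; cong      = λ {x} {y} → split-cong {x} {y}
    ; bijective = (λ {x} {y} → split-injective {x} {y}) , λ y → join y , λ {z} → split-join y z
    }

cut-bijection : ∀ a m cs → 0 < a → a < m → All (a <_) cs →
                Bijection (𝒫E-setoid m (a ∷ cs)) (×-setoid (𝒫-setoid a) (𝒫E-setoid (m ∸ a) (map (_∸ a) cs)))
cut-bijection (suc p) m cs _ a<m cs-after =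
  subst (λ n → Bijection (𝒫E-setoid n (suc p ∷ cs))
                         (×-setoid (𝒫-setoid (suc p)) (𝒫E-setoid (m ∸ suc p) (map (_∸ suc p) cs))))
    (m+[n∸m]≡n (<⇒≤ a<m)) (Cut.split-bijection p (m ∸ suc p) cs cs-after)

𝒫E-[]-bijection : ∀ m → Bijection (𝒫E-setoid m []) (∏𝒫 (m ∷ []))
𝒫E-[]-bijection m = record
  { to        = λ x → (proj₁ x , proj₁ (proj₂ x)) , tt
  ; cong      = λ σ≡σ′ → σ≡σ′ , refl
  ; bijective = proj₁ , λ ((σ , σ-perm) , _) → (σ , σ-perm , []) , λ σ≡σ′ → σ≡σ′ , refl
  }

shift-twice : ∀ d c xs → d ≤ c → map (_∸ (c ∸ d)) (map (_∸ d) xs) ≡ map (_∸ c) xs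
shift-twice d c xs d≤c = trans (sym (map-∘ xs))
  (map-cong (λ x → trans (∸-+-assoc x d (c ∸ d)) (cong (x ∸_) (m+[n∸m]≡n d≤c))) xs)

𝒫E-bijection : ∀ d n E → AllPairs _<_ E → All (λ c → d < c × c < n) E →
               Bijection (𝒫E-setoid (n ∸ d) (map (_∸ d) E)) (∏𝒫 (gaps d E n))
𝒫E-bijection d n []       _                       _                          = 𝒫E-[]-bijection (n ∸ d)
𝒫E-bijection d n (c ∷ cs) (c<cs ∷ cs-sorted) ((d<c , c<n) ∷ cs-bounds) =
  Composition.bijection
    (cut-bijection (c ∸ d) (n ∸ d) (map (_∸ d) cs) (m<n⇒0<n∸m d<c) (∸-monoˡ-< c<n (<⇒≤ d<c))
      (map⁺ (All.map (λ c<x → ∸-monoˡ-< c<x (<⇒≤ d<c)) c<cs)))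
    (Identity.bijection (𝒫-setoid (c ∸ d)) ×-bijection rest)
  where
  rest : Bijection (𝒫E-setoid (n ∸ d ∸ (c ∸ d)) (map (_∸ (c ∸ d)) (map (_∸ d) cs))) (∏𝒫 (gaps c cs n))
  rest = subst₂ (λ m E → Bijection (𝒫E-setoid m E) (∏𝒫 (gaps c cs n)))
    (sym (trans (∸-+-assoc n d (c ∸ d)) (cong (n ∸_) (m+[n∸m]≡n (<⇒≤ d<c)))))
    (sym (shift-twice d c cs (<⇒≤ d<c)))
    (𝒫E-bijection c n cs cs-sorted (All.zipWith (λ (c<x , _ , x<n) → c<x , x<n) (c<cs , cs-bounds)))

-- The hypothesis 1 ≤ n is implied by a₁ < n.
lemma2 : (n : ℕ) → 1 ≤ n → (a₁ : ℕ) → (as : List ℕ) → IsIndexSet n (a₁ ∷ as) →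
         Bijection (𝒫E-setoid n (a₁ ∷ as)) (∏𝒫 (gaps 0 (a₁ ∷ as) n))
lemma2 n _ a₁ as (sorted , bounds) =
  subst (λ E → Bijection (𝒫E-setoid n E) (∏𝒫 (gaps 0 (a₁ ∷ as) n))) (map-id (a₁ ∷ as))
    (𝒫E-bijection 0 n (a₁ ∷ as) (Linked⇒AllPairs <-trans sorted) bounds)
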